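{- If $G$ is a graph and $H=G-e$ for some edge $e\in E(G)$ that is not a bridge, then $\mathrm{sn}(G)-1\leq \mathrm{sn}(H)\leq \mathrm{sn}(G)$.
   Context: Graphs are finite, with multiple edges allowed but no loops. A bridge is an edge whose deletion disconnects the graph. An egg is a nonempty vertex subset inducing a connected subgraph; a scramble $\mathcal{S}$ is a collection of eggs; $h(\mathcal{S})$ is the minimum size of a vertex set meeting every egg; an egg-cut is an edge set whose deletion disconnects the graph into two components each containing an egg, and $e(\mathcal{S})$ is the minimum size of an egg-cut ($\infty$ if none); $\|\mathcal{S}\|=\min\{h(\mathcal{S}),e(\mathcal{S})\}$; $\mathrm{sn}(G)$ is the maximum order of a scramble on $G$. -}

module Defs where

open import Data.Nat using (ℕ; suc; _≤_; _⊓_)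
open import Data.Fin using (Fin)
open import Data.Fin.Subset using (Subset; _∈_; _∉_; ∁; ∣_∣; _⊆_; Nonempty)
open import Data.List using (List; length; lookup; removeAt)
open import Data.List.Relation.Unary.All using (All)
open import Data.List.Membership.Propositional using () renaming (_∈_ to _∈ₗ_)
open import Data.Product using (Σ; ∃; _×_; _,_; proj₁; proj₂)
open import Data.Sum using (_⊎_)
open import Relation.Binary.PropositionalEquality using (_≡_; _≢_)
open import Relation.Nullary using (¬_)

-- A finite multigraph: vertices Fin n, edges an (indexed) list of endpoint pairs.
-- Multiple edges are allowed (repeated pairs); loops are excluded by 'Loopless'.
record Graph : Set where
  constructor graph
  field
    n     : ℕ
    edges : List (Fin n × Fin n)
open Graph public

Edge : Graph → Set
Edge G = Fin (length (edges G))

ends : (G : Graph) → Edge G → Fin (n G) × Fin (n G)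
ends G i = lookup (edges G) i

Loopless : Graph → Set
Loopless G = All (λ uv → proj₁ uv ≢ proj₂ uv) (edges G)

deleteEdge : (G : Graph) → Edge G → Graph
deleteEdge G e = graph (n G) (removeAt (edges G) e)

Joins : (G : Graph) → Edge G → Fin (n G) → Fin (n G) → Set
Joins G i u w = (ends G i ≡ (u , w)) ⊎ (ends G i ≡ (w , u))

data Reach (G : Graph) (ok : Edge G → Set) (S : Subset (n G)) :
           Fin (n G) → Fin (n G) → Set where
  here : ∀ {u} → u ∈ S → Reach G ok S u u
  step : ∀ {u w v} (i : Edge G) → ok i → Joins G i u w → u ∈ S →
         Reach G ok S w v → Reach G ok S u v

ConnectedOn : (G : Graph) → (Edge G → Set) → Subset (n G) → Set
ConnectedOn G ok S = ∀ u v → u ∈ S → v ∈ S → Reach G ok S u v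

open import Data.Unit using (⊤)
import Data.Fin.Subset as Sub

Full : (m : ℕ) → Subset m
Full m = Sub.⊤

Connected : Graph → Set
Connected G = ConnectedOn G (λ _ → ⊤) (Full (n G))

Bridge : (G : Graph) → Edge G → Set
Bridge G e = ¬ Connected (deleteEdge G e)

Egg : (G : Graph) → Subset (n G) → Set
Egg G S = Nonempty S × ConnectedOn G (λ _ → ⊤) S

record Scramble (G : Graph) : Set where
  constructor scramble
  field
    eggs   : List (Subset (n G))
    isEggs : All (Egg G) eggs
open Scramble public

IsMin : (ℕ → Set) → ℕ → Set
IsMin P k = P k × (∀ j → P j → k ≤ j)

IsMax : (ℕ → Set) → ℕ → Set
IsMax P k = P k × (∀ j → P j → j ≤ k)

Hits : {G : Graph} → Scramble G → Subset (n G) → Set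
Hits 𝒮 T = ∀ E → E ∈ₗ eggs 𝒮 → ∃ λ v → v ∈ T × v ∈ E

HitSize : {G : Graph} → Scramble G → ℕ → Set
HitSize 𝒮 k = ∃ λ T → Hits 𝒮 T × ∣ T ∣ ≡ k

HNumber : {G : Graph} → Scramble G → ℕ → Set
HNumber 𝒮 = IsMin (HitSize 𝒮)

-- F is an egg-cut: G - F has exactly two components, A and its complement,
-- each of which contains an egg of 𝒮.
EggCut : {G : Graph} → Scramble G → Subset (length (edges G)) → Set
EggCut {G} 𝒮 F = ∃ λ (A : Subset (n G)) →
    (∀ i u w → i ∉ F → Joins G i u w → u ∈ A → w ∈ A)
  × (∀ i u w → i ∉ F → Joins G i u w → w ∈ A → u ∈ A)
  × ConnectedOn G (λ i → i ∉ F) A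
  × ConnectedOn G (λ i → i ∉ F) (∁ A)
  × (∃ λ E → E ∈ₗ eggs 𝒮 × E ⊆ A)
  × (∃ λ E → E ∈ₗ eggs 𝒮 × E ⊆ ∁ A)

EggCutSize : {G : Graph} → Scramble G → ℕ → Set
EggCutSize 𝒮 k = ∃ λ F → EggCut 𝒮 F × ∣ F ∣ ≡ k

-- e(𝒮) = k  (finite case; e(𝒮) = ∞ is the case ∀ k → ¬ EggCutSize 𝒮 k)
ENumber : {G : Graph} → Scramble G → ℕ → Set
ENumber 𝒮 = IsMin (EggCutSize 𝒮)

-- ‖𝒮‖ = k, where ‖𝒮‖ = min(h(𝒮), e(𝒮)) and min(h, ∞) = h
Order : {G : Graph} → Scramble G → ℕ → Set
Order 𝒮 k = Σ ℕ λ h → HNumber 𝒮 h ×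
   ( ((∀ j → ¬ EggCutSize 𝒮 j) × k ≡ h)
   ⊎ (Σ ℕ λ c → ENumber 𝒮 c × k ≡ h ⊓ c))

SN : Graph → ℕ → Set
SN G = IsMax (λ k → Σ (Scramble G) λ 𝒮 → Order 𝒮 k)

-- Write H = G − e and let u be an end of e.  A scramble on G restricts to H by keeping
-- the eggs that remain connected in H; every dropped egg contains u, so adding u to a
-- hitting set and e to an egg-cut of the restriction gives a hitting set and an egg-cut
-- of the original scramble: sn(G) ≤ sn(H) + 1.  Conversely, a scramble on H is one on G
-- with the same hitting sets, and an egg-cut of it in G leaves an edge set F of H such
-- that some side A, closed under the edges outside F, holds one egg while its complement
-- holds another.  As H is connected, F then contains an egg-cut: with D the component of
-- the second egg in the complement of A, and C the component of the first egg in the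
-- complement of D, both C and its complement are connected and every edge leaving C
-- lies in F.  Hence sn(H) ≤ sn(G).  The argument is classical, but it only concludes
-- inequalities between natural numbers, so it runs in the double-negation monad.

module Submission where

open import Defs
open import Data.Nat using (ℕ; zero; suc; _≤_; _<_; _≤?_; _+_; _⊓_; s≤s)
open import Data.Nat.Properties using (≤-refl; ≤-trans; ≮⇒≥; m⊓n≤m; m⊓n≤n; ⊓-sel; m≤n⇒m≤1+n)
open import Data.Nat.Induction using (<-rec)
open import Data.Fin using (Fin; zero; suc; _≟_)
open import Data.Fin.Subset using (Subset; _∈_; _∉_; ∁; ∣_∣; _⊆_; _∪_; ⁅_⁆; inside; outside)
open import Data.Fin.Subset.Properties
  using (_∈?_; ∈⊤; x∈∁p⇒x∉p; x∉p⇒x∈∁p; x∈⁅x⁆; p⊆p∪q; q⊆p∪q; p⊆q⇒∣p∣≤∣q∣; ∪-identityˡ)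
import Data.Fin.Subset as Subset
open import Data.Vec using ([]; _∷_; here; there)
open import Data.List using (List; []; _∷_; length; lookup; removeAt)
open import Data.List.Relation.Unary.All using (All; []; _∷_)
import Data.List.Relation.Unary.All as All
open import Data.List.Relation.Unary.Any using (here; there)
open import Data.List.Membership.Propositional using () renaming (_∈_ to _∈ₗ_)
open import Data.List.Relation.Binary.Subset.Propositional using () renaming (_⊆_ to _⊆ₗ_)
open import Data.Product using (∃; ∃-syntax; _×_; _,_; proj₁; proj₂)
import Data.Product as Product
open import Data.Sum using (_⊎_; inj₁; inj₂)
import Data.Sum as Sum
open import Data.Unit using (⊤; tt)
open import Function using (id; _∘_)
open import Relation.Binary.PropositionalEquality using (_≡_; _≢_; refl; sym; trans; cong; subst)
open import Relation.Nullary using (¬_; Dec; yes; no; ¬?)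
open import Relation.Nullary.Decidable using (decidable-stable; ¬¬-excluded-middle; _×-dec_; _⊎-dec_)
open import Relation.Nullary.Negation using (¬¬-Monad; contradiction)
open import Relation.Unary using (Decidable; _≐_)
open import Effect.Monad using (RawMonad)
open import Level using (0ℓ)
open RawMonad (¬¬-Monad {a = 0ℓ}) using (pure; _>>=_; _<$>_)

decidable⇒subset : ∀ {m} {P : Fin m → Set} → Decidable P → ∃[ C ] (_∈ C) ≐ P
decidable⇒subset {zero} P? = [] , (λ ()) , λ { {()} }
decidable⇒subset {suc _} P? with P? zero | decidable⇒subset (P? ∘ suc)
... | yes p | C , C⊆P , P⊆C =
  inside ∷ C , (λ { here → p ; (there x∈C) → C⊆P x∈C }) ,
  λ { {zero} _ → here ; {suc x} px → there (P⊆C px) }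
... | no ¬p | C , C⊆P , P⊆C =
  outside ∷ C , (λ { (there x∈C) → C⊆P x∈C }) ,
  λ { {zero} p → contradiction p ¬p ; {suc x} px → there (P⊆C px) }

¬¬-decidable : ∀ {m} (P : Fin m → Set) → ¬ ¬ Decidable P
¬¬-decidable {zero} P = pure λ ()
¬¬-decidable {suc _} P = do
  P₀? ← ¬¬-excluded-middle
  P∘suc? ← ¬¬-decidable (P ∘ suc)
  pure λ { zero → P₀? ; (suc x) → P∘suc? x }

¬¬-subset : ∀ {m} (P : Fin m → Set) → ¬ ¬ (∃[ C ] (_∈ C) ≐ P)
¬¬-subset P = decidable⇒subset <$> ¬¬-decidable P

¬¬-filter : ∀ {A : Set} (P : A → Set) (xs : List A) →
  ¬ ¬ (∃[ ys ] All P ys × ys ⊆ₗ xs × (∀ {x} → x ∈ₗ xs → x ∈ₗ ys ⊎ ¬ P x))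
¬¬-filter P [] = pure ([] , [] , (λ ()) , λ ())
¬¬-filter P (x ∷ xs) = do
  Px? ← ¬¬-excluded-middle
  (ys , Pys , ys⊆xs , kept) ← ¬¬-filter P xs
  pure (case Px? ys Pys ys⊆xs kept)
  where
  case : Dec (P x) → ∀ ys → All P ys → ys ⊆ₗ xs → (∀ {y} → y ∈ₗ xs → y ∈ₗ ys ⊎ ¬ P y) →
    ∃[ zs ] All P zs × zs ⊆ₗ x ∷ xs × (∀ {y} → y ∈ₗ x ∷ xs → y ∈ₗ zs ⊎ ¬ P y)
  case (yes Px) ys Pys ys⊆xs kept =
    x ∷ ys , Px ∷ Pys , (λ { (here refl) → here refl ; (there y∈) → there (ys⊆xs y∈) }) ,
    λ { (here refl) → inj₁ (here refl) ; (there y∈) → Sum.map₁ there (kept y∈) }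
  case (no ¬Px) ys Pys ys⊆xs kept =
    ys , Pys , there ∘ ys⊆xs , λ { (here refl) → inj₂ ¬Px ; (there y∈) → kept y∈ }

¬¬-least : ∀ {P : ℕ → Set} {j} → P j → ¬ ¬ ∃ (IsMin P)
¬¬-least {P} {j} = <-rec (λ j → P j → ¬ ¬ ∃ (IsMin P)) least-from j
  where
  least-from : ∀ j → (∀ {i} → i < j → P i → ¬ ¬ ∃ (IsMin P)) → P j → ¬ ¬ ∃ (IsMin P)
  least-from j below Pj = ¬¬-excluded-middle {A = ∃ λ i → i < j × P i} >>= λ where
    (yes (i , i<j , Pi)) → below i<j Pi
    (no none-below) → pure (j , Pj , λ i Pi → ≮⇒≥ (λ i<j → none-below (i , i<j , Pi)))

¬¬-least-or-none : ∀ {P : ℕ → Set} → ¬ ¬ ((∀ j → ¬ P j) ⊎ ∃ (IsMin P))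
¬¬-least-or-none {P} = ¬¬-excluded-middle {A = ∃ P} >>= λ where
  (yes (j , Pj)) → inj₂ <$> ¬¬-least Pj
  (no none) → pure (inj₁ λ j Pj → none (j , Pj))

module _ {K : Graph} where

  module _ {ok : Edge K → Set} {S : Subset (n K)} where

    reach-source : ∀ {x y} → Reach K ok S x y → x ∈ S
    reach-source (here x∈S) = x∈S
    reach-source (step _ _ _ x∈S _) = x∈S

    reach-target : ∀ {x y} → Reach K ok S x y → y ∈ S
    reach-target (here y∈S) = y∈S
    reach-target (step _ _ _ _ path) = reach-target path

    reach-trans : ∀ {x y z} → Reach K ok S x y → Reach K ok S y z → Reach K ok S x z
    reach-trans (here _) path′ = path′
    reach-trans (step i oki J x∈S path) path′ = step i oki J x∈S (reach-trans path path′)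

    reach-sym : ∀ {x y} → Reach K ok S x y → Reach K ok S y x
    reach-sym (here x∈S) = here x∈S
    reach-sym (step i oki J x∈S path) =
      reach-trans (reach-sym path) (step i oki (Sum.swap J) (reach-source path) (here x∈S))

  reach-mono : ∀ {ok ok′ : Edge K → Set} {S S′ x y} → (∀ {i} → ok i → ok′ i) → S ⊆ S′ →
    Reach K ok S x y → Reach K ok′ S′ x y
  reach-mono ok⇒ok′ S⊆S′ (here x∈S) = here (S⊆S′ x∈S)
  reach-mono ok⇒ok′ S⊆S′ (step i oki J x∈S path) =
    step i (ok⇒ok′ oki) J (S⊆S′ x∈S) (reach-mono ok⇒ok′ S⊆S′ path)

Closed : (K : Graph) → (Edge K → Set) → Subset (n K) → Set
Closed K ok A = ∀ i a b → ok i → Joins K i a b → a ∈ A → b ∈ A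

Component : (K : Graph) → Subset (n K) → Fin (n K) → Subset (n K) → Set
Component K W r C = (_∈ C) ≐ Reach K (λ _ → ⊤) W r

module _ {K : Graph} {W : Subset (n K)} {r : Fin (n K)} {C : Subset (n K)}
         (comp : Component K W r C) where

  component⊆ : C ⊆ W
  component⊆ x∈C = reach-target (proj₁ comp x∈C)

  component-step : ∀ {i a b} → a ∈ C → Joins K i a b → b ∈ W → b ∈ C
  component-step {i} a∈C J b∈W =
    proj₂ comp (reach-trans (proj₁ comp a∈C) (step i tt J (component⊆ a∈C) (here b∈W)))

  module _ {ok : Edge K → Set} (interior : ∀ {i a b} → Joins K i a b → a ∈ C → b ∈ C → ok i) where

    component-reach : ∀ {a y} → a ∈ C → Reach K (λ _ → ⊤) W a y → Reach K ok C a y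
    component-reach a∈C (here _) = here a∈C
    component-reach a∈C (step i _ J _ path) =
      step i (interior J a∈C b∈C) J a∈C (component-reach b∈C path)
      where b∈C = component-step a∈C J (reach-source path)

    component-connected : r ∈ W → ConnectedOn K ok C
    component-connected r∈W p q p∈C q∈C = reach-trans (reach-sym (from-root p∈C)) (from-root q∈C)
      where
      from-root : ∀ {x} → x ∈ C → Reach K ok C r x
      from-root x∈C = component-reach (proj₂ comp (here r∈W)) (proj₁ comp x∈C)

Crosses : ∀ {m} → Subset m → Fin m × Fin m → Set
Crosses C (a , b) = (a ∈ C × b ∉ C) ⊎ (a ∉ C × b ∈ C)

crosses? : ∀ {m} (C : Subset m) → Decidable (Crosses C)
crosses? C (a , b) = (a ∈? C ×-dec ¬? (b ∈? C)) ⊎-dec (¬? (a ∈? C) ×-dec b ∈? C)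

boundary : (K : Graph) → Subset (n K) → Subset (length (edges K))
boundary K C = proj₁ (decidable⇒subset (λ i → crosses? C (ends K i)))

module Boundary (K : Graph) (C : Subset (n K)) where

  private
    boundary-spec : (_∈ boundary K C) ≐ (λ i → Crosses C (ends K i))
    boundary-spec = proj₂ (decidable⇒subset (λ i → crosses? C (ends K i)))

  crosses-swap : ∀ {a b} → Crosses C (a , b) → Crosses C (b , a)
  crosses-swap = Sum.swap ∘ Sum.map Product.swap Product.swap

  ∈boundary⇒crosses : ∀ {i a b} → Joins K i a b → i ∈ boundary K C → Crosses C (a , b)
  ∈boundary⇒crosses (inj₁ ends≡ab) i∈∂C = subst (Crosses C) ends≡ab (proj₁ boundary-spec i∈∂C)
  ∈boundary⇒crosses (inj₂ ends≡ba) i∈∂C =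
    crosses-swap (subst (Crosses C) ends≡ba (proj₁ boundary-spec i∈∂C))

  crosses⇒∈boundary : ∀ {i a b} → Joins K i a b → Crosses C (a , b) → i ∈ boundary K C
  crosses⇒∈boundary (inj₁ ends≡ab) ab = proj₂ boundary-spec (subst (Crosses C) (sym ends≡ab) ab)
  crosses⇒∈boundary (inj₂ ends≡ba) ab =
    proj₂ boundary-spec (subst (Crosses C) (sym ends≡ba) (crosses-swap ab))

  interior∉boundary : ∀ {i a b} → Joins K i a b → a ∈ C → b ∈ C → i ∉ boundary K C
  interior∉boundary J a∈C b∈C i∈∂C with ∈boundary⇒crosses J i∈∂C
  ... | inj₁ (_ , b∉C) = b∉C b∈C
  ... | inj₂ (a∉C , _) = a∉C a∈C

  exterior∉boundary : ∀ {i a b} → Joins K i a b → a ∉ C → b ∉ C → i ∉ boundary K C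
  exterior∉boundary J a∉C b∉C i∈∂C with ∈boundary⇒crosses J i∈∂C
  ... | inj₁ (a∈C , _) = a∉C a∈C
  ... | inj₂ (_ , b∈C) = b∉C b∈C

  boundary-closed : Closed K (λ i → i ∉ boundary K C) C
  boundary-closed i a b i∉∂C J a∈C with b ∈? C
  ... | yes b∈C = b∈C
  ... | no b∉C = contradiction (crosses⇒∈boundary J (inj₁ (a∈C , b∉C))) i∉∂C

eggCut : ∀ {K} {𝒮 : Scramble K} {F A} → Closed K (λ i → i ∉ F) A →
  ConnectedOn K (λ i → i ∉ F) A → ConnectedOn K (λ i → i ∉ F) (∁ A) →
  (∃ λ E → E ∈ₗ eggs 𝒮 × E ⊆ A) → (∃ λ E → E ∈ₗ eggs 𝒮 × E ⊆ ∁ A) → EggCut 𝒮 F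
eggCut {A = A} closed A-connected ∁A-connected egg-in-A egg-outside-A =
  A , closed , (λ i a b i∉F J b∈A → closed i b a i∉F (Sum.swap J) b∈A) ,
  A-connected , ∁A-connected , egg-in-A , egg-outside-A

module Separation {K : Graph} (connected : Connected K)
  {F : Subset (length (edges K))} {A : Subset (n K)} (closed : Closed K (λ i → i ∉ F) A)
  {x₁ x₂ : Fin (n K)} (x₁∈A : x₁ ∈ A) (x₂∈∁A : x₂ ∈ ∁ A)
  {D C : Subset (n K)} (D-comp : Component K (∁ A) x₂ D) (C-comp : Component K (∁ D) x₁ C) where

  open Boundary K C

  private
    AvoidsBoundary : Edge K → Set
    AvoidsBoundary i = i ∉ boundary K C

    ∉D : ∀ {y} → y ∈ C → y ∉ D
    ∉D y∈C = x∈∁p⇒x∉p (component⊆ C-comp y∈C)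

    ∉C : ∀ {y} → y ∈ D → y ∉ C
    ∉C y∈D y∈C = ∉D y∈C y∈D

    D⊆∁C : D ⊆ ∁ C
    D⊆∁C = x∉p⇒x∈∁p ∘ ∉C

    A⊆∁D : A ⊆ ∁ D
    A⊆∁D a∈A = x∉p⇒x∈∁p (λ a∈D → x∈∁p⇒x∉p (component⊆ D-comp a∈D) a∈A)

    x₂∈D : x₂ ∈ D
    x₂∈D = proj₂ D-comp (here x₂∈∁A)

    D-reaches-x₂ : ∀ {y} → y ∈ D → Reach K AvoidsBoundary (∁ C) y x₂
    D-reaches-x₂ y∈D = reach-mono id D⊆∁C (D-connected _ _ y∈D x₂∈D)
      where
      D-connected : ConnectedOn K AvoidsBoundary D
      D-connected =
        component-connected D-comp (λ J a∈D b∈D → exterior∉boundary J (∉C a∈D) (∉C b∈D)) x₂∈∁A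

    -- A vertex outside C ∪ D has no neighbour in C (a component of ∁ D),
    -- so a path may be followed in ∁ C until it enters D.
    reaches-x₂ : ∀ {y z} → Reach K (λ _ → ⊤) (Full (n K)) y z → z ∈ D → y ∉ C →
      Reach K AvoidsBoundary (∁ C) y x₂
    reaches-x₂ (here _) z∈D _ = D-reaches-x₂ z∈D
    reaches-x₂ {y} (step {w = w} i _ J _ path) z∈D y∉C with y ∈? D | w ∈? C
    ... | yes y∈D | _ = D-reaches-x₂ y∈D
    ... | no y∉D | yes w∈C =
      contradiction (component-step C-comp w∈C (Sum.swap J) (x∉p⇒x∈∁p y∉D)) y∉C
    ... | no _ | no w∉C =
      step i (exterior∉boundary J y∉C w∉C) J (x∉p⇒x∈∁p y∉C) (reaches-x₂ path z∈D w∉C)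

    leaving-C∈F : ∀ {i a b} → Joins K i a b → a ∈ C → b ∉ C → i ∈ F
    leaving-C∈F {i} {a} {b} J a∈C b∉C with i ∈? F | b ∈? D
    ... | yes i∈F | _ = i∈F
    ... | no _ | no b∉D = contradiction (component-step C-comp a∈C J (x∉p⇒x∈∁p b∉D)) b∉C
    ... | no i∉F | yes b∈D with a ∈? A
    ...   | yes a∈A =
      contradiction (closed i a b i∉F J a∈A) (x∈∁p⇒x∉p (component⊆ D-comp b∈D))
    ...   | no a∉A =
      contradiction (component-step D-comp b∈D (Sum.swap J) (x∉p⇒x∈∁p a∉A)) (∉D a∈C)

  C-connected : ConnectedOn K AvoidsBoundary C
  C-connected = component-connected C-comp interior∉boundary (A⊆∁D x₁∈A)

  ∁C-connected : ConnectedOn K AvoidsBoundary (∁ C)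
  ∁C-connected p q p∈∁C q∈∁C = reach-trans (to-x₂ p∈∁C) (reach-sym (to-x₂ q∈∁C))
    where
    to-x₂ : ∀ {y} → y ∈ ∁ C → Reach K AvoidsBoundary (∁ C) y x₂
    to-x₂ {y} y∈∁C = reaches-x₂ (connected y x₂ ∈⊤ ∈⊤) x₂∈D (x∈∁p⇒x∉p y∈∁C)

  boundary⊆F : boundary K C ⊆ F
  boundary⊆F i∈∂C with ∈boundary⇒crosses (inj₁ refl) i∈∂C
  ... | inj₁ (a∈C , b∉C) = leaving-C∈F (inj₁ refl) a∈C b∉C
  ... | inj₂ (a∉C , b∈C) = leaving-C∈F (inj₂ refl) b∈C a∉C

  ⊆C : ∀ {E} → ConnectedOn K (λ _ → ⊤) E → x₁ ∈ E → E ⊆ A → E ⊆ C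
  ⊆C E-connected x₁∈E E⊆A y∈E =
    proj₂ C-comp (reach-mono id (A⊆∁D ∘ E⊆A) (E-connected _ _ x₁∈E y∈E))

  ⊆∁C : ∀ {E} → ConnectedOn K (λ _ → ⊤) E → x₂ ∈ E → E ⊆ ∁ A → E ⊆ ∁ C
  ⊆∁C E-connected x₂∈E E⊆∁A y∈E =
    D⊆∁C (proj₂ D-comp (reach-mono id E⊆∁A (E-connected _ _ x₂∈E y∈E)))

separator⊇eggCut : ∀ {K} → Connected K → (𝒮 : Scramble K) →
  ∀ {F A} → Closed K (λ i → i ∉ F) A →
  (∃ λ E → E ∈ₗ eggs 𝒮 × E ⊆ A) → (∃ λ E → E ∈ₗ eggs 𝒮 × E ⊆ ∁ A) →
  ¬ ¬ (∃[ F′ ] EggCut 𝒮 F′ × F′ ⊆ F)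
separator⊇eggCut {K} connected 𝒮 {F} {A} closed (E₁ , E₁∈𝒮 , E₁⊆A) (E₂ , E₂∈𝒮 , E₂⊆∁A)
  with All.lookup (isEggs 𝒮) E₁∈𝒮 | All.lookup (isEggs 𝒮) E₂∈𝒮
... | (x₁ , x₁∈E₁) , E₁-connected | (x₂ , x₂∈E₂) , E₂-connected = do
  (D , D-comp) ← ¬¬-subset (Reach K (λ _ → ⊤) (∁ A) x₂)
  (C , C-comp) ← ¬¬-subset (Reach K (λ _ → ⊤) (∁ D) x₁)
  pure (cut D-comp C-comp)
  where
  cut : ∀ {D C} → Component K (∁ A) x₂ D → Component K (∁ D) x₁ C → ∃[ F′ ] EggCut 𝒮 F′ × F′ ⊆ F
  cut {C = C} D-comp C-comp =
    boundary K C ,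
    eggCut {K} {𝒮} boundary-closed C-connected ∁C-connected
      (E₁ , E₁∈𝒮 , ⊆C E₁-connected x₁∈E₁ E₁⊆A) (E₂ , E₂∈𝒮 , ⊆∁C E₂-connected x₂∈E₂ E₂⊆∁A) ,
    boundary⊆F
    where open Separation connected closed (E₁⊆A x₁∈E₁) (E₂⊆∁A x₂∈E₂) D-comp C-comp
          open Boundary K C

module _ {K : Graph} (𝒮 : Scramble K) where

  order≤hitting : ∀ {k T} → Order 𝒮 k → Hits 𝒮 T → k ≤ ∣ T ∣
  order≤hitting (h , (_ , h-least) , inj₁ (_ , refl)) hits = h-least _ (_ , hits , refl)
  order≤hitting (h , (_ , h-least) , inj₂ (c , _ , refl)) hits =
    ≤-trans (m⊓n≤m h c) (h-least _ (_ , hits , refl))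

  order≤eggCut : ∀ {k F} → Order 𝒮 k → EggCut 𝒮 F → k ≤ ∣ F ∣
  order≤eggCut (_ , _ , inj₁ (no-cut , _)) cut = contradiction (_ , cut , refl) (no-cut _)
  order≤eggCut (h , _ , inj₂ (c , (_ , c-least) , refl)) cut =
    ≤-trans (m⊓n≤n h c) (c-least _ (_ , cut , refl))

  order-attained : ∀ {k} → Order 𝒮 k → HitSize 𝒮 k ⊎ EggCutSize 𝒮 k
  order-attained (h , (h-attained , _) , inj₁ (_ , refl)) = inj₁ h-attained
  order-attained (h , (h-attained , _) , inj₂ (c , (c-attained , _) , refl)) with ⊓-sel h c
  ... | inj₁ h⊓c≡h = inj₁ (subst (HitSize 𝒮) (sym h⊓c≡h) h-attained)
  ... | inj₂ h⊓c≡c = inj₂ (subst (EggCutSize 𝒮) (sym h⊓c≡c) c-attained)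

  order-exists : ¬ ¬ ∃ (Order 𝒮)
  order-exists = do
    (h , h-least) ← ¬¬-least (Subset.⊤ , all-hits , refl)
    ¬¬-least-or-none >>= λ where
      (inj₁ no-cut) → pure (h , h , h-least , inj₁ (no-cut , refl))
      (inj₂ (c , c-least)) → pure (h ⊓ c , h , h-least , inj₂ (c , c-least , refl))
    where
    all-hits : Hits 𝒮 Subset.⊤
    all-hits E E∈𝒮 = let (x , x∈E) = proj₁ (All.lookup (isEggs 𝒮) E∈𝒮) in x , ∈⊤ , x∈E

-- The order is the size of a hitting set or of an egg-cut, and a lower bound on both.
order-≤-by-transfer : ∀ {K L} (𝒮 : Scramble K) (𝒯 : Scramble L) {s t} (d : ℕ) →
  (∀ {T} → Hits 𝒯 T → ∃[ T′ ] Hits 𝒮 T′ × ∣ T′ ∣ ≤ d + ∣ T ∣) →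
  (∀ {F} → EggCut 𝒯 F → ¬ ¬ (∃[ F′ ] EggCut 𝒮 F′ × ∣ F′ ∣ ≤ d + ∣ F ∣)) →
  Order 𝒮 s → Order 𝒯 t → s ≤ d + t
order-≤-by-transfer 𝒮 𝒯 {s} d transfer-hits transfer-cut ord𝒮 ord𝒯 with order-attained 𝒯 ord𝒯
... | inj₁ (T , hits , refl) =
  let (T′ , hits′ , ∣T′∣≤) = transfer-hits hits in ≤-trans (order≤hitting 𝒮 ord𝒮 hits′) ∣T′∣≤
... | inj₂ (F , cut , refl) = decidable-stable (s ≤? d + ∣ F ∣) do
  (F′ , cut′ , ∣F′∣≤) ← transfer-cut cut
  pure (≤-trans (order≤eggCut 𝒮 ord𝒮 cut′) ∣F′∣≤)

∣⁅x⁆∪p∣≤1+∣p∣ : ∀ {m} (x : Fin m) (p : Subset m) → ∣ ⁅ x ⁆ ∪ p ∣ ≤ suc ∣ p ∣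
∣⁅x⁆∪p∣≤1+∣p∣ zero (outside ∷ p) rewrite ∪-identityˡ p = ≤-refl
∣⁅x⁆∪p∣≤1+∣p∣ zero (inside ∷ p) rewrite ∪-identityˡ p = m≤n⇒m≤1+n ≤-refl
∣⁅x⁆∪p∣≤1+∣p∣ (suc x) (outside ∷ p) = ∣⁅x⁆∪p∣≤1+∣p∣ x p
∣⁅x⁆∪p∣≤1+∣p∣ (suc x) (inside ∷ p) = s≤s (∣⁅x⁆∪p∣≤1+∣p∣ x p)

module _ {X : Set} where

  skip : (xs : List X) (k : Fin (length xs)) → Fin (length (removeAt xs k)) → Fin (length xs)
  skip (x ∷ xs) zero i = suc i
  skip (x ∷ xs) (suc k) zero = zero
  skip (x ∷ xs) (suc k) (suc i) = suc (skip xs k i)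

  lookup-removeAt : ∀ (xs : List X) k i → lookup (removeAt xs k) i ≡ lookup xs (skip xs k i)
  lookup-removeAt (x ∷ xs) zero i = refl
  lookup-removeAt (x ∷ xs) (suc k) zero = refl
  lookup-removeAt (x ∷ xs) (suc k) (suc i) = lookup-removeAt xs k i

  skip-onto : ∀ (xs : List X) k j → j ≢ k → ∃[ i ] skip xs k i ≡ j
  skip-onto (x ∷ xs) zero zero j≢k = contradiction refl j≢k
  skip-onto (x ∷ xs) zero (suc j) _ = j , refl
  skip-onto (x ∷ xs) (suc k) zero _ = zero , refl
  skip-onto (x ∷ xs) (suc k) (suc j) j≢k =
    let (i , skip≡j) = skip-onto xs k j (j≢k ∘ cong suc) in suc i , cong suc skip≡j

  restrict : ∀ (xs : List X) k → Subset (length xs) → Subset (length (removeAt xs k))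
  restrict (x ∷ xs) zero (_ ∷ F) = F
  restrict (x ∷ xs) (suc k) (b ∷ F) = b ∷ restrict xs k F

  restrict-∈ : ∀ (xs : List X) k F i → skip xs k i ∈ F → i ∈ restrict xs k F
  restrict-∈ (x ∷ xs) zero (_ ∷ F) i (there i∈F) = i∈F
  restrict-∈ (x ∷ xs) (suc k) (_ ∷ F) zero here = here
  restrict-∈ (x ∷ xs) (suc k) (_ ∷ F) (suc i) (there i∈F) = there (restrict-∈ xs k F i i∈F)

  ∣restrict∣≤ : ∀ (xs : List X) k F → ∣ restrict xs k F ∣ ≤ ∣ F ∣
  ∣restrict∣≤ (x ∷ xs) zero (outside ∷ F) = ≤-refl
  ∣restrict∣≤ (x ∷ xs) zero (inside ∷ F) = m≤n⇒m≤1+n ≤-refl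
  ∣restrict∣≤ (x ∷ xs@(_ ∷ _)) (suc k) (outside ∷ F) = ∣restrict∣≤ xs k F
  ∣restrict∣≤ (x ∷ xs@(_ ∷ _)) (suc k) (inside ∷ F) = s≤s (∣restrict∣≤ xs k F)

  extend : ∀ (xs : List X) k → Subset (length (removeAt xs k)) → Subset (length xs)
  extend (x ∷ xs) zero F = inside ∷ F
  extend (x ∷ xs) (suc k) (b ∷ F) = b ∷ extend xs k F

  k∈extend : ∀ (xs : List X) k F → k ∈ extend xs k F
  k∈extend (x ∷ xs) zero F = here
  k∈extend (x ∷ xs) (suc k) (_ ∷ F) = there (k∈extend xs k F)

  skip∈extend⁺ : ∀ (xs : List X) k F i → i ∈ F → skip xs k i ∈ extend xs k F
  skip∈extend⁺ (x ∷ xs) zero F i i∈F = there i∈F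
  skip∈extend⁺ (x ∷ xs) (suc k) (_ ∷ F) zero here = here
  skip∈extend⁺ (x ∷ xs) (suc k) (_ ∷ F) (suc i) (there i∈F) =
    there (skip∈extend⁺ xs k F i i∈F)

  skip∈extend⁻ : ∀ (xs : List X) k F i → skip xs k i ∈ extend xs k F → i ∈ F
  skip∈extend⁻ (x ∷ xs) zero F i (there i∈F) = i∈F
  skip∈extend⁻ (x ∷ xs) (suc k) (_ ∷ F) zero here = here
  skip∈extend⁻ (x ∷ xs) (suc k) (_ ∷ F) (suc i) (there i∈F) =
    there (skip∈extend⁻ xs k F i i∈F)

  ∣extend∣≤ : ∀ (xs : List X) k F → ∣ extend xs k F ∣ ≤ suc ∣ F ∣
  ∣extend∣≤ (x ∷ xs) zero F = ≤-refl
  ∣extend∣≤ (x ∷ xs@(_ ∷ _)) (suc k) (outside ∷ F) = ∣extend∣≤ xs k F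
  ∣extend∣≤ (x ∷ xs@(_ ∷ _)) (suc k) (inside ∷ F) = s≤s (∣extend∣≤ xs k F)

module EdgeDeletion (G : Graph) (e : Edge G) where

  H : Graph
  H = deleteEdge G e

  ι : Edge H → Edge G
  ι = skip (edges G) e

  u : Fin (n G)
  u = proj₁ (ends G e)

  private
    ends-ι : ∀ i → ends H i ≡ ends G (ι i)
    ends-ι = lookup-removeAt (edges G) e

  joins-ι : ∀ {i a b} → Joins H i a b → Joins G (ι i) a b
  joins-ι {i} = Sum.map (trans (sym (ends-ι i))) (trans (sym (ends-ι i)))

  ι-joins : ∀ {i a b} → Joins G (ι i) a b → Joins H i a b
  ι-joins {i} = Sum.map (trans (ends-ι i)) (trans (ends-ι i))

  reach-ι : ∀ {ok : Edge H → Set} {ok′ : Edge G → Set} {S x y} → (∀ {i} → ok i → ok′ (ι i)) →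
    Reach H ok S x y → Reach G ok′ S x y
  reach-ι ok⇒ok′ (here x∈S) = here x∈S
  reach-ι ok⇒ok′ (step i oki J x∈S path) =
    step (ι i) (ok⇒ok′ oki) (joins-ι J) x∈S (reach-ι ok⇒ok′ path)

  reach-avoiding-e : ∀ {ok : Edge G → Set} {S x y} →
    (∀ {j a b} → Joins G j a b → a ∈ S → b ∈ S → j ≢ e) →
    Reach G ok S x y → Reach H (λ _ → ⊤) S x y
  reach-avoiding-e avoids (here x∈S) = here x∈S
  reach-avoiding-e avoids (step j _ J x∈S path) =
    let (i , ιi≡j) = skip-onto (edges G) e j (avoids J x∈S (reach-source path))
    in step i tt (ι-joins (subst (λ j → Joins G j _ _) (sym ιi≡j) J)) x∈S
            (reach-avoiding-e avoids path)

  egg-ι : ∀ {E} → Egg H E → Egg G E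
  egg-ι (nonempty , connected) = nonempty , λ p q p∈E q∈E → reach-ι id (connected p q p∈E q∈E)

  egg-without-u : ∀ {E} → Egg G E → u ∉ E → Egg H E
  egg-without-u {E} (nonempty , connected) u∉E =
    nonempty , λ p q p∈E q∈E → reach-avoiding-e avoids (connected p q p∈E q∈E)
    where
    avoids : ∀ {j a b} → Joins G j a b → a ∈ E → b ∈ E → j ≢ e
    avoids (inj₁ ends≡ab) a∈E _ refl = u∉E (subst (_∈ E) (sym (cong proj₁ ends≡ab)) a∈E)
    avoids (inj₂ ends≡ba) _ b∈E refl = u∉E (subst (_∈ E) (sym (cong proj₁ ends≡ba)) b∈E)

  liftScramble : Scramble H → Scramble G
  liftScramble 𝒯 = scramble (eggs 𝒯) (All.map egg-ι (isEggs 𝒯))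

  ¬¬-restriction : (𝒮 : Scramble G) →
    ¬ ¬ (∃[ 𝒯 ] eggs 𝒯 ⊆ₗ eggs 𝒮 × (∀ {E} → E ∈ₗ eggs 𝒮 → E ∈ₗ eggs 𝒯 ⊎ u ∈ E))
  ¬¬-restriction 𝒮 = restriction <$> ¬¬-filter (Egg H) (eggs 𝒮)
    where
    u∈ : ∀ {E} → E ∈ₗ eggs 𝒮 → ¬ Egg H E → u ∈ E
    u∈ {E} E∈𝒮 not-egg =
      decidable-stable (u ∈? E) (not-egg ∘ egg-without-u (All.lookup (isEggs 𝒮) E∈𝒮))

    restriction :
      ∃[ L ] All (Egg H) L × L ⊆ₗ eggs 𝒮 × (∀ {E} → E ∈ₗ eggs 𝒮 → E ∈ₗ L ⊎ ¬ Egg H E) →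
      ∃[ 𝒯 ] eggs 𝒯 ⊆ₗ eggs 𝒮 × (∀ {E} → E ∈ₗ eggs 𝒮 → E ∈ₗ eggs 𝒯 ⊎ u ∈ E)
    restriction (L , L-eggs , L⊆𝒮 , kept) =
      scramble L L-eggs , L⊆𝒮 , λ E∈𝒮 → Sum.map₂ (u∈ E∈𝒮) (kept E∈𝒮)

  hits-with-u : ∀ {𝒮 : Scramble G} {𝒯 : Scramble H} {T} →
    (∀ {E} → E ∈ₗ eggs 𝒮 → E ∈ₗ eggs 𝒯 ⊎ u ∈ E) → Hits 𝒯 T → Hits 𝒮 (⁅ u ⁆ ∪ T)
  hits-with-u {T = T} kept hits E E∈𝒮 with kept E∈𝒮
  ... | inj₁ E∈𝒯 = let (v , v∈T , v∈E) = hits E E∈𝒯 in v , q⊆p∪q ⁅ u ⁆ T v∈T , v∈E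
  ... | inj₂ u∈E = u , p⊆p∪q T (x∈⁅x⁆ u) , u∈E

  eggCut-extend : ∀ {𝒮 : Scramble G} {𝒯 : Scramble H} {F} →
    eggs 𝒯 ⊆ₗ eggs 𝒮 → EggCut 𝒯 F → EggCut 𝒮 (extend (edges G) e F)
  eggCut-extend {𝒮} {F = F} 𝒯⊆𝒮
    (A , closed , _ , A-connected , ∁A-connected , (E₁ , E₁∈𝒯 , E₁⊆A) , (E₂ , E₂∈𝒯 , E₂⊆∁A)) =
    eggCut {G} {𝒮} closed′ (lift A-connected) (lift ∁A-connected)
      (E₁ , 𝒯⊆𝒮 E₁∈𝒯 , E₁⊆A) (E₂ , 𝒯⊆𝒮 E₂∈𝒯 , E₂⊆∁A)
    where
    F⁺ = extend (edges G) e F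

    closed′ : Closed G (λ j → j ∉ F⁺) A
    closed′ j a b j∉F⁺ J a∈A with j ≟ e
    ... | yes refl = contradiction (k∈extend (edges G) e F) j∉F⁺
    ... | no j≢e =
      let (i , ιi≡j) = skip-onto (edges G) e j j≢e
      in closed i a b (j∉F⁺ ∘ subst (_∈ F⁺) ιi≡j ∘ skip∈extend⁺ (edges G) e F i)
           (ι-joins (subst (λ j → Joins G j a b) (sym ιi≡j) J)) a∈A

    lift : ∀ {S} → ConnectedOn H (λ i → i ∉ F) S → ConnectedOn G (λ j → j ∉ F⁺) S
    lift connected p q p∈S q∈S =
      reach-ι (λ {i} i∉F → i∉F ∘ skip∈extend⁻ (edges G) e F i) (connected p q p∈S q∈S)

  eggCut-restrict : Connected H → ∀ {𝒯 : Scramble H} {F} →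
    EggCut (liftScramble 𝒯) F → ¬ ¬ (∃[ F′ ] EggCut 𝒯 F′ × ∣ F′ ∣ ≤ ∣ F ∣)
  eggCut-restrict connected {𝒯} {F} (A , closed , _ , _ , _ , egg-in-A , egg-outside-A) = do
    (F′ , cut , F′⊆) ← separator⊇eggCut connected 𝒯 closed′ egg-in-A egg-outside-A
    pure (F′ , cut , ≤-trans (p⊆q⇒∣p∣≤∣q∣ F′⊆) (∣restrict∣≤ (edges G) e F))
    where
    closed′ : Closed H (λ i → i ∉ restrict (edges G) e F) A
    closed′ i a b i∉F J = closed (ι i) a b (i∉F ∘ restrict-∈ (edges G) e F i) (joins-ι J)

  ¬¬-restriction-order : ∀ (𝒮 : Scramble G) {s} → Order 𝒮 s →
    ¬ ¬ (∃[ 𝒯 ] ∃[ k ] Order 𝒯 k × s ≤ suc k)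
  ¬¬-restriction-order 𝒮 ord𝒮 = do
    (𝒯 , 𝒯⊆𝒮 , kept) ← ¬¬-restriction 𝒮
    (k , ord𝒯) ← order-exists 𝒯
    pure (𝒯 , k , ord𝒯 , order-≤-by-transfer 𝒮 𝒯 1
      (λ {T} hits → ⁅ u ⁆ ∪ T , hits-with-u {𝒮} {𝒯} kept hits , ∣⁅x⁆∪p∣≤1+∣p∣ u T)
      (λ {F} cut → pure (_ , eggCut-extend {𝒮} {𝒯} 𝒯⊆𝒮 cut , ∣extend∣≤ (edges G) e F))
      ord𝒮 ord𝒯)

  order≤lift-order : Connected H → ∀ (𝒯 : Scramble H) {t k} →
    Order 𝒯 t → Order (liftScramble 𝒯) k → t ≤ k
  order≤lift-order connected 𝒯 =
    order-≤-by-transfer 𝒯 (liftScramble 𝒯) 0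
      (λ hits → _ , hits , ≤-refl) (eggCut-restrict connected {𝒯})

corollary3p3 : (G : Graph) → Loopless G → (e : Edge G) → ¬ Bridge G e →
    ∀ (s t : ℕ) → SN G s → SN (deleteEdge G e) t →
    (s ≤ suc t) × (t ≤ s)
corollary3p3 G _ e not-bridge s t ((𝒮 , ord𝒮) , s-max) ((𝒯 , ord𝒯) , t-max) =
  decidable-stable (s ≤? suc t) (do
    (𝒮⁻ , k , ord𝒮⁻ , s≤1+k) ← ¬¬-restriction-order 𝒮 ord𝒮
    pure (≤-trans s≤1+k (s≤s (t-max k (𝒮⁻ , ord𝒮⁻))))) ,
  decidable-stable (t ≤? s) (do
    connected ← not-bridge
    (k , ord) ← order-exists (liftScramble 𝒯)
    pure (≤-trans (order≤lift-order connected 𝒯 ord𝒯 ord) (s-max k (liftScramble 𝒯 , ord))))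
  where open EdgeDeletion G e
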